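{- Consider the Static Black-Peg AB Game with $p=3$ pegs and $c\ge 5$ colors. Then: (a) If a feasible strategy contains no $(1,1,1)$-question, then in total it contains at most six questions which are $(1,1,\ge 2)$-questions, $(1,\ge 2,1)$-questions or $(\ge 2,1,1)$-questions. (b) If a feasible strategy contains no $(1,1,1)$-question and for each of two of the pegs there is a color which does not occur on that peg, then in total it contains at most five questions which are $(1,1,\ge 2)$-questions, $(1,\ge 2,1)$-questions or $(\ge 2,1,1)$-questions.
   Context: Static Black-Peg AB Game with $p$ pegs and $c\ge p$ colors $1,\dots,c$: secrets and questions are ordered $p$-tuples $(x_1\,|\,\dots\,|\,x_p)$ of pairwise distinct colors; the answer to question $Q$ for secret $S$ is the number of positions $i$ with $q_i=s_i$. A strategy is a list of pairwise distinct questions asked all at once; it is feasible if any two distinct secrets receive different vectors of answers. A color occurs on peg $i$ if it is the $i$-th entry of some question of the strategy. For a question $Q=(q_1|\dots|q_p)$ of a strategy, $Q$ is an $(a_1,\dots,a_p)$-question if for each $i$ the color $q_i$ occurs exactly $a_i$ times as the $i$-th entry among all questions of the strategy (including $Q$); an entry "$\ge a_i$" means $q_i$ occurs at least $a_i$ times as the $i$-th entry. -}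

module Defs where

open import Data.Nat using (ℕ; zero; suc; _+_; _≤_; _≥_)
open import Data.Fin using (Fin)
open import Data.Fin as Fin using ()
open import Data.Bool using (Bool; _∧_; _∨_)
open import Data.Fin.Properties using () renaming (_≟_ to _≟ᶠ_)
open import Data.Product using (_×_; _,_; ∃)
open import Data.List using (List; length; filter)
open import Data.List.Membership.Propositional using (_∈_)
open import Data.List.Relation.Unary.All using (All)
open import Data.List.Relation.Unary.Unique.Propositional using (Unique)
open import Relation.Binary.PropositionalEquality using (_≡_; _≢_)
open import Relation.Nullary using (¬_; Dec; yes; no)
open import Relation.Nullary.Decidable using (⌊_⌋)

-- Pegs are indexed by Fin 3 (pegs 1,2,3 ↦ 0,1,2); colors by Fin c.
-- A question / secret is an ordered triple of colors (x₁ | x₂ | x₃).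
Triple : ℕ → Set
Triple c = Fin c × Fin c × Fin c

peg₁ peg₂ peg₃ : ∀ {c} → Triple c → Fin c
peg₁ (a , _ , _) = a
peg₂ (_ , b , _) = b
peg₃ (_ , _ , d) = d

Valid : ∀ {c} → Triple c → Set
Valid (a , b , d) = a ≢ b × a ≢ d × b ≢ d

eqℕ : ∀ {c} → Fin c → Fin c → ℕ
eqℕ x y with x ≟ᶠ y
... | yes _ = 1
... | no  _ = 0

answer : ∀ {c} → Triple c → Triple c → ℕ
answer (q₁ , q₂ , q₃) (s₁ , s₂ , s₃) = eqℕ q₁ s₁ + eqℕ q₂ s₂ + eqℕ q₃ s₃

Strategy : ∀ {c} → List (Triple c) → Set
Strategy qs = All Valid qs × Unique qs

Feasible : ∀ {c} → List (Triple c) → Set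
Feasible {c} qs = (s t : Triple c) → Valid s → Valid t →
  All (λ q → answer q s ≡ answer q t) qs → s ≡ t

occ : ∀ {c} → (Triple c → Fin c) → List (Triple c) → Fin c → ℕ
occ pg qs x = length (filter (λ q → pg q ≟ᶠ x) qs)

m₁ m₂ m₃ : ∀ {c} → List (Triple c) → Triple c → ℕ
m₁ qs q = occ peg₁ qs (peg₁ q)
m₂ qs q = occ peg₂ qs (peg₂ q)
m₃ qs q = occ peg₃ qs (peg₃ q)

Is111 : ∀ {c} → List (Triple c) → Triple c → Set
Is111 qs q = m₁ qs q ≡ 1 × m₂ qs q ≡ 1 × m₃ qs q ≡ 1

_≟1 : (n : ℕ) → Dec (n ≡ 1)
zero ≟1 = no (λ ())
suc zero ≟1 = yes _≡_.refl
suc (suc n) ≟1 = no (λ ())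

_≥2? : (n : ℕ) → Dec (n ≥ 2)
zero ≥2? = no (λ ())
suc zero ≥2? = no (λ { (Data.Nat.s≤s ()) })
suc (suc n) ≥2? = yes (Data.Nat.s≤s (Data.Nat.s≤s Data.Nat.z≤n))

isSpecial : ∀ {c} → List (Triple c) → Triple c → Bool
isSpecial qs q =
     (⌊ m₁ qs q ≟1 ⌋ ∧ ⌊ m₂ qs q ≟1 ⌋ ∧ ⌊ m₃ qs q ≥2? ⌋)
  ∨ (⌊ m₁ qs q ≟1 ⌋ ∧ ⌊ m₂ qs q ≥2? ⌋ ∧ ⌊ m₃ qs q ≟1 ⌋)
  ∨ (⌊ m₁ qs q ≥2? ⌋ ∧ ⌊ m₂ qs q ≟1 ⌋ ∧ ⌊ m₃ qs q ≟1 ⌋)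


numSpecial : ∀ {c} → List (Triple c) → ℕ
numSpecial qs = length (Data.List.filterᵇ (isSpecial qs) qs)

Absent : ∀ {c} → (Triple c → Fin c) → List (Triple c) → Fin c → Set
Absent pg qs x = ¬ (∃ λ q → q ∈ qs × pg q ≡ x)

pegAt : ∀ {c} → Fin 3 → Triple c → Fin c
pegAt Fin.zero = peg₁
pegAt (Fin.suc Fin.zero) = peg₂
pegAt (Fin.suc (Fin.suc Fin.zero)) = peg₃

MissesColor : ∀ {c} → List (Triple c) → Fin 3 → Set
MissesColor {c} qs i = ∃ λ (x : Fin c) → Absent (pegAt i) qs x

-- Write A, B, C for the (1,1,≥2)-, (1,≥2,1)- and (≥2,1,1)-questions; a question of A is the
-- only one showing its colour on peg 1 and the only one showing its colour on peg 2, so every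
-- question shows the first colour iff it shows the second. Hence for two questions (a|b|_) and
-- (a′|b′|_) of A with b ≠ a′ and b′ ≠ a, the secrets (a|b′|w) and (a′|b|w), w a fifth colour,
-- would get identical answers; read as arrows a ↦ b, the questions of A therefore pairwise
-- continue one another, which leaves room for at most three. Likewise one question of each of
-- A, B, C forces a coincidence among their colours. A short case analysis of these constraints
-- shows that if one class has three members the other two have at most three together, so
-- there are at most six special questions. For (b), colours u, v missing on pegs i and j
-- behave like an extra (i,j)-question (u, v) that no question meets, and the same bound
-- applies with it included.

module Submission where

open import Defs
open import Data.Nat using (ℕ; suc; _+_; _≤_; _≥_; _<_; z≤n; s≤s; _≤?_)
open import Data.Nat.Properties
  using (≤-refl; ≤-trans; ≤-pred; ≰⇒>; +-mono-≤; +-comm; +-assoc; +-suc; +-commutativeSemigroup;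
         module ≤-Reasoning)
open import Algebra.Properties.CommutativeSemigroup +-commutativeSemigroup
  using (xy∙z≈xz∙y; xy∙z≈yz∙x; xy∙z≈zx∙y)
open import Data.Fin using (Fin) renaming (zero to fzero; suc to fsuc)
open import Data.Fin.Properties using (_≟_; pigeonhole; any?; <⇒≢)
open import Data.Bool using (Bool; true; false; T; _∧_; _∨_)
open import Data.Bool.Properties using (T-∨)
open import Data.Product using (_×_; _,_; ∃; proj₁; proj₂)
open import Data.Sum using (_⊎_; inj₁; inj₂; map; swap; [_,_])
open import Data.Empty using (⊥; ⊥-elim)
open import Function using (id; _∘_; flip)
open import Function.Bundles using (_⇔_; mk⇔; Equivalence)
open import Data.List using (List; []; _∷_; length; filterᵇ; lookup)
open import Data.List.Membership.Propositional using (_∈_; _∉_)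
open import Data.List.Membership.Propositional.Properties using (∈-filter⁺; ∈-filter⁻)
open import Data.List.Relation.Binary.Subset.Propositional using (_⊆_)
open import Data.List.Relation.Unary.Any using (here; there; index)
open import Data.List.Relation.Unary.Any.Properties using (lookup-index)
open import Data.List.Relation.Unary.All as All using (_∷_)
open import Data.List.Relation.Unary.AllPairs using (_∷_)
open import Data.List.Relation.Unary.Unique.Propositional using (Unique)
open import Data.List.Relation.Unary.Unique.Propositional.Properties using (filter⁺)
open import Relation.Binary.PropositionalEquality
  using (_≡_; _≢_; refl; sym; trans; cong; cong₂; subst; module ≡-Reasoning)
open import Relation.Nullary using (¬_; Dec; yes; no; ¬?)
open import Relation.Nullary.Decidable using (⌊_⌋; decidable-stable; T?)

Distinct₃ : {A : Set} → A → A → A → Set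
Distinct₃ x y z = x ≢ y × x ≢ z × y ≢ z

≢-sym : {A : Set} {x y : A} → x ≢ y → y ≢ x
≢-sym x≢y y≡x = x≢y (sym y≡x)

clash : {A : Set} {x y z : A} → x ≢ y → x ≡ z → y ≡ z → ⊥
clash x≢y x≡z y≡z = x≢y (trans x≡z (sym y≡z))

size-split : ∀ {m n} → m ≤ 3 → n ≤ 3 → 4 ≤ m + n →
  (3 ≤ m × 1 ≤ n) ⊎ (1 ≤ m × 3 ≤ n) ⊎ (2 ≤ m × 2 ≤ n)
size-split z≤n n≤3 4≤n with ≤-trans 4≤n n≤3
... | s≤s (s≤s (s≤s ()))
size-split (s≤s z≤n) _ (s≤s 3≤n) = inj₂ (inj₁ (s≤s z≤n , 3≤n))
size-split (s≤s (s≤s z≤n)) _ (s≤s (s≤s 2≤n)) = inj₂ (inj₂ (≤-refl , 2≤n))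
size-split (s≤s (s≤s (s≤s z≤n))) _ (s≤s (s≤s (s≤s 1≤n))) = inj₁ (≤-refl , 1≤n)

sum≤6 : ∀ {a b c} → a ≤ 3 → b ≤ 3 → c ≤ 3 →
  (3 ≤ a → b + c ≤ 3) → (3 ≤ b → a + c ≤ 3) → (3 ≤ c → a + b ≤ 3) → a + b + c ≤ 6
sum≤6 {a} {b} {c} a≤3 b≤3 c≤3 big-a big-b big-c with 3 ≤? a | 3 ≤? b | 3 ≤? c
... | yes 3≤a | _ | _ rewrite +-assoc a b c = +-mono-≤ a≤3 (big-a 3≤a)
... | _ | yes 3≤b | _ rewrite +-comm a b | +-assoc b a c = +-mono-≤ b≤3 (big-b 3≤b)
... | _ | _ | yes 3≤c = +-mono-≤ (big-c 3≤c) c≤3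
... | no a<3 | no b<3 | no c<3 = +-mono-≤ (+-mono-≤ (≤2 a<3) (≤2 b<3)) (≤2 c<3)
  where
  ≤2 : ∀ {n} → ¬ (3 ≤ n) → n ≤ 2
  ≤2 3≰n = ≤-pred (≰⇒> 3≰n)

module _ {A : Set} where

  three-distinct : ∀ {xs : List A} → Unique xs → 3 ≤ length xs →
    ∃ λ x → ∃ λ y → ∃ λ z → x ∈ xs × y ∈ xs × z ∈ xs × Distinct₃ x y z
  three-distinct {x ∷ y ∷ z ∷ _} ((x≢y ∷ x≢z ∷ _) ∷ (y≢z ∷ _) ∷ _) _ =
    x , y , z , here refl , there (here refl) , there (there (here refl)) , x≢y , x≢z , y≢z
  three-distinct {[]} _ ()
  three-distinct {_ ∷ []} _ (s≤s ())
  three-distinct {_ ∷ _ ∷ []} _ (s≤s (s≤s ()))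

  two-distinct : ∀ {xs : List A} → Unique xs → 2 ≤ length xs →
    ∃ λ x → ∃ λ y → x ∈ xs × y ∈ xs × x ≢ y
  two-distinct {x ∷ y ∷ _} ((x≢y ∷ _) ∷ _) _ = x , y , here refl , there (here refl) , x≢y
  two-distinct {[]} _ ()
  two-distinct {_ ∷ []} _ (s≤s ())

  four-distinct : ∀ {xs : List A} → Unique xs → 4 ≤ length xs →
    ∃ λ w → w ∈ xs × ∃ λ x → ∃ λ y → ∃ λ z → x ∈ xs × y ∈ xs × z ∈ xs ×
      (w ≢ x × w ≢ y × w ≢ z) × Distinct₃ x y z
  four-distinct {w ∷ x ∷ y ∷ z ∷ _} ((w≢x ∷ w≢y ∷ w≢z ∷ _) ∷ (x≢y ∷ x≢z ∷ _) ∷ (y≢z ∷ _) ∷ _) _ =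
    w , here refl , x , y , z , there (here refl) , there (there (here refl)) ,
    there (there (there (here refl))) , (w≢x , w≢y , w≢z) , x≢y , x≢z , y≢z
  four-distinct {[]} _ ()
  four-distinct {_ ∷ []} _ (s≤s ())
  four-distinct {_ ∷ _ ∷ []} _ (s≤s (s≤s ()))
  four-distinct {_ ∷ _ ∷ _ ∷ []} _ (s≤s (s≤s (s≤s ())))

  nonempty : ∀ {xs : List A} → 1 ≤ length xs → ∃ λ x → x ∈ xs
  nonempty {x ∷ _} _ = x , here refl

module Arrows {Col : Set} where

  pigeonhole-⊎ : ∀ {u v a₁ a₂ a₃ b₁ b₂ b₃ : Col} → Distinct₃ a₁ a₂ a₃ → Distinct₃ b₁ b₂ b₃ →
    a₁ ≡ u ⊎ b₁ ≡ v → a₂ ≡ u ⊎ b₂ ≡ v → a₃ ≡ u ⊎ b₃ ≡ v → ⊥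
  pigeonhole-⊎ (a₁₂ , _ , _) _ (inj₁ e₁) (inj₁ e₂) _ = clash a₁₂ e₁ e₂
  pigeonhole-⊎ _ (b₁₂ , _ , _) (inj₂ e₁) (inj₂ e₂) _ = clash b₁₂ e₁ e₂
  pigeonhole-⊎ (_ , a₁₃ , _) _ (inj₁ e₁) (inj₂ _) (inj₁ e₃) = clash a₁₃ e₁ e₃
  pigeonhole-⊎ _ (_ , _ , b₂₃) (inj₁ _) (inj₂ e₂) (inj₂ e₃) = clash b₂₃ e₂ e₃
  pigeonhole-⊎ (_ , _ , a₂₃) _ (inj₂ _) (inj₁ e₂) (inj₁ e₃) = clash a₂₃ e₂ e₃
  pigeonhole-⊎ _ (_ , b₁₃ , _) (inj₂ e₁) (inj₁ _) (inj₂ e₃) = clash b₁₃ e₁ e₃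

  Repeats : Col → Col → Col → Set
  Repeats x y z = x ≡ y ⊎ x ≡ z ⊎ y ≡ z

  Repeats-swap₂₃ : ∀ {x y z} → Repeats x y z → Repeats x z y
  Repeats-swap₂₃ (inj₁ e) = inj₂ (inj₁ e)
  Repeats-swap₂₃ (inj₂ (inj₁ e)) = inj₁ e
  Repeats-swap₂₃ (inj₂ (inj₂ e)) = inj₂ (inj₂ (sym e))

  Repeats-reverse : ∀ {x y z} → Repeats x y z → Repeats z y x
  Repeats-reverse (inj₁ e) = inj₂ (inj₂ (sym e))
  Repeats-reverse (inj₂ (inj₁ e)) = inj₂ (inj₁ (sym e))
  Repeats-reverse (inj₂ (inj₂ e)) = inj₁ (sym e)

  record Family (X : Set) : Set where
    field
      members : List X
      unique : Unique members
      tail head : X → Col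
      tail-injective : ∀ {x y} → x ∈ members → y ∈ members → x ≢ y → tail x ≢ tail y
      head-injective : ∀ {x y} → x ∈ members → y ∈ members → x ≢ y → head x ≢ head y
      linked : ∀ {x y} → x ∈ members → y ∈ members → x ≢ y → head x ≡ tail y ⊎ head y ≡ tail x

    size : ℕ
    size = length members

    Proper : Set
    Proper = ∀ {x} → x ∈ members → tail x ≢ head x

    reverse : Family X
    reverse = record
      { members = members ; unique = unique ; tail = head ; head = tail
      ; tail-injective = head-injective ; head-injective = tail-injective
      ; linked = λ x∈ y∈ x≢y → swap (map sym sym (linked x∈ y∈ x≢y)) }

    record Three : Set where
      constructor three
      field
        {x y z} : X
        x∈ : x ∈ members
        y∈ : y ∈ members
        z∈ : z ∈ members
        x≢y : x ≢ y
        x≢z : x ≢ z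
        y≢z : y ≢ z

      tails-distinct : Distinct₃ (tail x) (tail y) (tail z)
      tails-distinct = tail-injective x∈ y∈ x≢y , tail-injective x∈ z∈ x≢z , tail-injective y∈ z∈ y≢z

      heads-distinct : Distinct₃ (head x) (head y) (head z)
      heads-distinct =
        head-injective x∈ y∈ x≢y , head-injective x∈ z∈ x≢z , head-injective y∈ z∈ y≢z

    record Two : Set where
      constructor two
      field
        {x y} : X
        x∈ : x ∈ members
        y∈ : y ∈ members
        distinct : x ≢ y

    One : Set
    One = ∃ λ x → x ∈ members

    three-of-size : 3 ≤ size → Three
    three-of-size 3≤size =
      let (_ , _ , _ , x∈ , y∈ , z∈ , x≢y , x≢z , y≢z) = three-distinct unique 3≤size in
      three x∈ y∈ z∈ x≢y x≢z y≢z

    two-of-size : 2 ≤ size → Two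
    two-of-size 2≤size = let (_ , _ , x∈ , y∈ , x≢y) = two-distinct unique 2≤size in two x∈ y∈ x≢y

    one-of-size : 1 ≤ size → One
    one-of-size = nonempty

    head-is-tail : ∀ {x y z} → x ∈ members → y ∈ members → z ∈ members → Distinct₃ x y z →
      ∃ λ w → w ∈ members × head x ≡ tail w
    head-is-tail x∈ y∈ z∈ (x≢y , x≢z , y≢z) with linked x∈ y∈ x≢y | linked x∈ z∈ x≢z
    ... | inj₁ e | _ = _ , y∈ , e
    ... | inj₂ _ | inj₁ e = _ , z∈ , e
    ... | inj₂ e | inj₂ e′ = ⊥-elim (clash (head-injective y∈ z∈ y≢z) e e′)

    tail-is-head : ∀ {x y z} → x ∈ members → y ∈ members → z ∈ members → Distinct₃ x y z →
      ∃ λ w → w ∈ members × tail x ≡ head w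
    tail-is-head x∈ y∈ z∈ (x≢y , x≢z , y≢z) with linked x∈ y∈ x≢y | linked x∈ z∈ x≢z
    ... | inj₂ e | _ = _ , y∈ , sym e
    ... | inj₁ _ | inj₂ e = _ , z∈ , sym e
    ... | inj₁ e | inj₁ e′ = ⊥-elim (clash (tail-injective y∈ z∈ y≢z) (sym e) (sym e′))

    size≤3 : size ≤ 3
    size≤3 with size ≤? 3
    ... | yes size≤3 = size≤3
    ... | no size≰3 with four-distinct unique (≰⇒> size≰3)
    ...   | _ , w∈ , _ , _ , _ , x∈ , y∈ , z∈ , (w≢x , w≢y , w≢z) , x≢y , x≢z , y≢z =
      ⊥-elim (pigeonhole-⊎ (Three.tails-distinct t) (Three.heads-distinct t)
        (map sym id (linked w∈ x∈ w≢x)) (map sym id (linked w∈ y∈ w≢y)) (map sym id (linked w∈ z∈ w≢z)))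
      where
      t : Three
      t = three x∈ y∈ z∈ x≢y x≢z y≢z

  open Family

  reverse-Proper : ∀ {X} (F : Family X) → Proper F → Proper (reverse F)
  reverse-Proper F proper x∈ e = proper x∈ (sym e)

  -- Each row and each column of the square uses one disjunct of each kind.
  meeting-square : ∀ {H₁ T₁ H₂ T₂ t₁ h₁ t₂ h₂ : Col} →
    H₁ ≡ t₁ ⊎ T₁ ≡ h₁ → H₁ ≡ t₂ ⊎ T₁ ≡ h₂ → H₂ ≡ t₁ ⊎ T₂ ≡ h₁ → H₂ ≡ t₂ ⊎ T₂ ≡ h₂ →
    H₁ ≢ H₂ → T₁ ≢ T₂ → t₁ ≢ t₂ → h₁ ≢ h₂ →
    (H₁ ≡ t₁ × T₁ ≡ h₂ × T₂ ≡ h₁ × H₂ ≡ t₂) ⊎ (T₁ ≡ h₁ × H₁ ≡ t₂ × H₂ ≡ t₁ × T₂ ≡ h₂)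
  meeting-square (inj₁ a) (inj₁ b) _ _ _ _ t₁≢t₂ _ = ⊥-elim (t₁≢t₂ (trans (sym a) b))
  meeting-square _ _ (inj₁ a) (inj₁ b) _ _ t₁≢t₂ _ = ⊥-elim (t₁≢t₂ (trans (sym a) b))
  meeting-square (inj₂ a) (inj₂ b) _ _ _ _ _ h₁≢h₂ = ⊥-elim (h₁≢h₂ (trans (sym a) b))
  meeting-square _ _ (inj₂ a) (inj₂ b) _ _ _ h₁≢h₂ = ⊥-elim (h₁≢h₂ (trans (sym a) b))
  meeting-square (inj₁ a) _ (inj₁ b) _ H₁≢H₂ _ _ _ = ⊥-elim (clash H₁≢H₂ a b)
  meeting-square (inj₂ a) _ (inj₂ b) _ _ T₁≢T₂ _ _ = ⊥-elim (clash T₁≢T₂ a b)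
  meeting-square (inj₁ a) (inj₂ b) (inj₂ c) (inj₁ d) _ _ _ _ = inj₁ (a , b , c , d)
  meeting-square (inj₂ a) (inj₁ b) (inj₁ c) (inj₂ d) _ _ _ _ = inj₂ (a , b , c , d)

  -- Through the square, a link between T and H closes a loop t = h, and conversely.
  square-loops : ∀ {H₁ T₁ H₂ T₂ t₁ h₁ t₂ h₂ : Col} →
    (H₁ ≡ t₁ × T₁ ≡ h₂ × T₂ ≡ h₁ × H₂ ≡ t₂) ⊎ (T₁ ≡ h₁ × H₁ ≡ t₂ × H₂ ≡ t₁ × T₂ ≡ h₂) →
    H₁ ≡ T₂ ⊎ H₂ ≡ T₁ → h₁ ≡ t₂ ⊎ h₂ ≡ t₁ → (T₁ ≡ H₁ ⊎ T₂ ≡ H₂) × (t₁ ≡ h₁ ⊎ t₂ ≡ h₂)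
  square-loops (inj₁ (a , b , c , d)) linkT linkt =
    map (λ e → trans b (trans e (sym a))) (λ e → trans c (trans e (sym d))) (swap linkt) ,
    map (λ e → trans (sym a) (trans e c)) (λ e → trans (sym d) (trans e b)) linkT
  square-loops (inj₂ (a , b , c , d)) linkT linkt =
    map (λ e → trans a (trans e (sym b))) (λ e → trans d (trans e (sym c))) linkt ,
    map (λ e → trans (sym c) (trans e a)) (λ e → trans (sym b) (trans e d)) (swap linkT)

  -- In the game, A, B, C are the (1,1,≥2)-, (1,≥2,1)- and (≥2,1,1)-questions, read as arrows
  -- peg₁ ↦ peg₂, peg₁ ↦ peg₃ and peg₂ ↦ peg₃; collision says that the secrets
  -- (tail p | tail r | head q) and (tail q | head p | head r) cannot both be valid.
  record Configuration (X : Set) : Set where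
    field
      A B C : Family X
      tails-AB : ∀ {x y} → x ∈ members A → y ∈ members B → tail A x ≢ tail B y
      head-tail-AC : ∀ {x y} → x ∈ members A → y ∈ members C → head A x ≢ tail C y
      heads-BC : ∀ {x y} → x ∈ members B → y ∈ members C → head B x ≢ head C y
      collision : ∀ {p q r} → p ∈ members A → q ∈ members B → r ∈ members C →
        Repeats (tail A p) (tail C r) (head B q) ⊎ Repeats (tail B q) (head A p) (head C r)

  module ThreeInA {X : Set} (K : Configuration X) (t : Three (Configuration.A K)) where
    open Configuration K

    Meets : X → X → Set
    Meets q r = head B q ≡ tail C r ⊎ tail B q ≡ head C r

    meets-or-hits : ∀ {p p′ p″ q r} → p ∈ members A → p′ ∈ members A → p″ ∈ members A →
      Distinct₃ p p′ p″ → q ∈ members B → r ∈ members C →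
      Meets q r ⊎ (tail A p ≡ head B q ⊎ head A p ≡ head C r)
    meets-or-hits p∈ p′∈ p″∈ d q∈ r∈ with collision p∈ q∈ r∈
    ... | inj₁ (inj₁ e) = let (w , w∈ , e′) = tail-is-head A p∈ p′∈ p″∈ d in
      ⊥-elim (head-tail-AC w∈ r∈ (trans (sym e′) e))
    ... | inj₁ (inj₂ (inj₁ e)) = inj₂ (inj₁ e)
    ... | inj₁ (inj₂ (inj₂ e)) = inj₁ (inj₁ (sym e))
    ... | inj₂ (inj₁ e) = let (w , w∈ , e′) = head-is-tail A p∈ p′∈ p″∈ d in
      ⊥-elim (tails-AB w∈ q∈ (sym (trans e e′)))
    ... | inj₂ (inj₂ (inj₁ e)) = inj₁ (inj₂ e)
    ... | inj₂ (inj₂ (inj₂ e)) = inj₂ (inj₂ e)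

    open Three t

    meets : ∀ {q r} → q ∈ members B → r ∈ members C → Meets q r
    meets q∈ r∈ with meets-or-hits x∈ y∈ z∈ (x≢y , x≢z , y≢z) q∈ r∈
                   | meets-or-hits y∈ x∈ z∈ (≢-sym x≢y , y≢z , x≢z) q∈ r∈
                   | meets-or-hits z∈ x∈ y∈ (≢-sym x≢z , ≢-sym y≢z , x≢y) q∈ r∈
    ... | inj₁ m | _ | _ = m
    ... | inj₂ _ | inj₁ m | _ = m
    ... | inj₂ _ | inj₂ _ | inj₁ m = m
    ... | inj₂ h₁ | inj₂ h₂ | inj₂ h₃ = ⊥-elim (pigeonhole-⊎ tails-distinct heads-distinct h₁ h₂ h₃)

    no-three-one : Three B → One C → ⊥
    no-three-one t′ (_ , r∈) =
      pigeonhole-⊎ (Three.heads-distinct t′) (Three.tails-distinct t′)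
        (meets (Three.x∈ t′) r∈) (meets (Three.y∈ t′) r∈) (meets (Three.z∈ t′) r∈)

    no-one-three : One B → Three C → ⊥
    no-one-three (_ , q∈) t′ =
      pigeonhole-⊎ (Three.tails-distinct t′) (Three.heads-distinct t′)
        (map sym sym (meets q∈ (Three.x∈ t′))) (map sym sym (meets q∈ (Three.y∈ t′)))
        (map sym sym (meets q∈ (Three.z∈ t′)))

    no-two-two : Proper B ⊎ Proper C → Two B → Two C → ⊥
    no-two-two proper (two q₁∈ q₂∈ q₁≢q₂) (two r₁∈ r₂∈ r₁≢r₂)
      with square-loops
             (meeting-square (meets q₁∈ r₁∈) (meets q₁∈ r₂∈) (meets q₂∈ r₁∈) (meets q₂∈ r₂∈)
               (head-injective B q₁∈ q₂∈ q₁≢q₂) (tail-injective B q₁∈ q₂∈ q₁≢q₂)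
               (tail-injective C r₁∈ r₂∈ r₁≢r₂) (head-injective C r₁∈ r₂∈ r₁≢r₂))
             (linked B q₁∈ q₂∈ q₁≢q₂) (linked C r₁∈ r₂∈ r₁≢r₂)
    ... | loop-B , loop-C with proper
    ...   | inj₁ proper-B = [ proper-B q₁∈ , proper-B q₂∈ ] loop-B
    ...   | inj₂ proper-C = [ proper-C r₁∈ , proper-C r₂∈ ] loop-C

    crowding : Proper B ⊎ Proper C → size B + size C ≤ 3
    crowding proper with size B + size C ≤? 3
    ... | yes small = small
    ... | no large with size-split (size≤3 B) (size≤3 C) (≰⇒> large)
    ...   | inj₁ (3≤B , 1≤C) = ⊥-elim (no-three-one (three-of-size B 3≤B) (one-of-size C 1≤C))
    ...   | inj₂ (inj₁ (1≤B , 3≤C)) = ⊥-elim (no-one-three (one-of-size B 1≤B) (three-of-size C 3≤C))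
    ...   | inj₂ (inj₂ (2≤B , 2≤C)) = ⊥-elim (no-two-two proper (two-of-size B 2≤B) (two-of-size C 2≤C))

  swap-AB : ∀ {X} → Configuration X → Configuration X
  swap-AB K = record
    { A = B ; B = A ; C = reverse C
    ; tails-AB = λ x∈ y∈ → ≢-sym (tails-AB y∈ x∈)
    ; head-tail-AC = heads-BC
    ; heads-BC = head-tail-AC
    ; collision = λ p∈ q∈ r∈ → swap (map Repeats-swap₂₃ Repeats-swap₂₃ (collision q∈ p∈ r∈)) }
    where open Configuration K

  swap-AC : ∀ {X} → Configuration X → Configuration X
  swap-AC K = record
    { A = reverse C ; B = reverse B ; C = reverse A
    ; tails-AB = λ x∈ y∈ → ≢-sym (heads-BC y∈ x∈)
    ; head-tail-AC = λ x∈ y∈ → ≢-sym (head-tail-AC y∈ x∈)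
    ; heads-BC = λ x∈ y∈ → ≢-sym (tails-AB y∈ x∈)
    ; collision = λ p∈ q∈ r∈ → swap (map Repeats-reverse Repeats-reverse (collision r∈ q∈ p∈)) }
    where open Configuration K

  size-bound : ∀ {X} (K : Configuration X) → let open Configuration K in
    Proper A ⊎ Proper B → Proper A ⊎ Proper C → Proper B ⊎ Proper C →
    size A + size B + size C ≤ 6
  size-bound K AB AC BC = sum≤6 (size≤3 A) (size≤3 B) (size≤3 C)
    (λ 3≤A → ThreeInA.crowding K (three-of-size A 3≤A) BC)
    (λ 3≤B → ThreeInA.crowding (swap-AB K) (three-of-size B 3≤B) (map id (reverse-Proper C) AC))
    (λ 3≤C → subst (_≤ 3) (+-comm (size B) (size A))
      (ThreeInA.crowding (swap-AC K) (three-of-size (reverse C) 3≤C)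
        (map (reverse-Proper B) (reverse-Proper A) (swap AB))))
    where open Configuration K

module _ {c : ℕ} where
  open Equivalence using (to; from)

  eqℕ-⇔ : ∀ {x y a b : Fin c} → (x ≡ a ⇔ y ≡ b) → eqℕ x a ≡ eqℕ y b
  eqℕ-⇔ {x} {y} {a} {b} x≡a⇔y≡b with x ≟ a | y ≟ b
  ... | yes _ | yes _ = refl
  ... | no _ | no _ = refl
  ... | yes x≡a | no y≢b = ⊥-elim (y≢b (to x≡a⇔y≡b x≡a))
  ... | no x≢a | yes y≡b = ⊥-elim (x≢a (from x≡a⇔y≡b y≡b))

  -- Under the pairings, both sides are sums of the same indicators.
  hits-exchange₂ : ∀ {x y a b a′ b′ : Fin c} → (x ≡ a ⇔ y ≡ b) → (x ≡ a′ ⇔ y ≡ b′) →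
    eqℕ x a + eqℕ y b′ ≡ eqℕ x a′ + eqℕ y b
  hits-exchange₂ {x} {y} {a} {b} {a′} {b′} ab a′b′ =
    trans (cong₂ _+_ (eqℕ-⇔ ab) (sym (eqℕ-⇔ a′b′))) (+-comm (eqℕ y b) (eqℕ x a′))

  hits-exchange₃ : ∀ {x₁ x₂ x₃ a₁ b₁ a₂ g₂ b₃ g₃ : Fin c} →
    (x₁ ≡ a₁ ⇔ x₂ ≡ b₁) → (x₁ ≡ a₂ ⇔ x₃ ≡ g₂) → (x₂ ≡ b₃ ⇔ x₃ ≡ g₃) →
    eqℕ x₁ a₁ + eqℕ x₂ b₃ + eqℕ x₃ g₂ ≡ eqℕ x₁ a₂ + eqℕ x₂ b₁ + eqℕ x₃ g₃
  hits-exchange₃ {x₁} {x₂} {x₃} {a₁} {b₁} {a₂} {g₂} {b₃} {g₃} o₁ o₂ o₃ = begin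
    eqℕ x₁ a₁ + eqℕ x₂ b₃ + eqℕ x₃ g₂ ≡⟨ cong (eqℕ x₁ a₁ + eqℕ x₂ b₃ +_) (sym (eqℕ-⇔ o₂)) ⟩
    eqℕ x₁ a₁ + eqℕ x₂ b₃ + eqℕ x₁ a₂ ≡⟨ xy∙z≈zx∙y (eqℕ x₁ a₁) (eqℕ x₂ b₃) (eqℕ x₁ a₂) ⟩
    eqℕ x₁ a₂ + eqℕ x₁ a₁ + eqℕ x₂ b₃ ≡⟨ cong₂ _+_ (cong (eqℕ x₁ a₂ +_) (eqℕ-⇔ o₁)) (eqℕ-⇔ o₃) ⟩
    eqℕ x₁ a₂ + eqℕ x₂ b₁ + eqℕ x₃ g₃ ∎
    where open ≡-Reasoning

module _ {n : ℕ} where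
  open import Data.List.Membership.DecPropositional (_≟_ {n}) using (_∈?_)

  ¬covering : (xs : List (Fin n)) → length xs < n → ¬ (∀ w → w ∈ xs)
  ¬covering xs length<n covering with pigeonhole length<n (index ∘ covering)
  ... | i , j , i<j , same-index = <⇒≢ i<j (begin
    i                               ≡⟨ lookup-index (covering i) ⟩
    lookup xs (index (covering i))  ≡⟨ cong (lookup xs) same-index ⟩
    lookup xs (index (covering j))  ≡⟨ lookup-index (covering j) ⟨
    j                               ∎)
    where open ≡-Reasoning

  length<⇒∃∉ : (xs : List (Fin n)) → length xs < n → ∃ λ w → w ∉ xs
  length<⇒∃∉ xs length<n with any? (λ w → ¬? (w ∈? xs))
  ... | yes fresh = fresh
  ... | no none = ⊥-elim (¬covering xs length<n λ w → decidable-stable (w ∈? xs) (λ w∉ → none (w , w∉)))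

record PegPair (c : ℕ) : Set where
  field
    first second third : Triple c → Fin c
    place : Fin c → Fin c → Fin c → Triple c
    first-place : ∀ {a b w} → first (place a b w) ≡ a
    valid-place : ∀ {a b w} → a ≢ b → w ≢ a → w ≢ b → Valid (place a b w)
    answer-place : ∀ r {a b w} →
      answer r (place a b w) ≡ eqℕ (first r) a + eqℕ (second r) b + eqℕ (third r) w
    valid⇒distinct : ∀ {q} → Valid q → first q ≢ second q

pegs₁₂ pegs₁₃ pegs₂₃ : ∀ {c} → PegPair c
pegs₁₂ = record
  { first = peg₁ ; second = peg₂ ; third = peg₃ ; place = λ a b w → a , b , w
  ; first-place = refl
  ; valid-place = λ a≢b w≢a w≢b → a≢b , ≢-sym w≢a , ≢-sym w≢b
  ; answer-place = λ _ → refl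
  ; valid⇒distinct = proj₁ }
pegs₁₃ = record
  { first = peg₁ ; second = peg₃ ; third = peg₂ ; place = λ a b w → a , w , b
  ; first-place = refl
  ; valid-place = λ a≢b w≢a w≢b → ≢-sym w≢a , a≢b , w≢b
  ; answer-place = λ (r₁ , r₂ , r₃) {a b w} → xy∙z≈xz∙y (eqℕ r₁ a) (eqℕ r₂ w) (eqℕ r₃ b)
  ; valid⇒distinct = proj₁ ∘ proj₂ }
pegs₂₃ = record
  { first = peg₂ ; second = peg₃ ; third = peg₁ ; place = λ a b w → w , a , b
  ; first-place = refl
  ; valid-place = λ a≢b w≢a w≢b → w≢a , w≢b , a≢b
  ; answer-place = λ (r₁ , r₂ , r₃) {a b w} → xy∙z≈yz∙x (eqℕ r₁ w) (eqℕ r₂ a) (eqℕ r₃ b)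
  ; valid⇒distinct = proj₂ ∘ proj₂ }

repeats? : ∀ {c} (x y z : Fin c) → Arrows.Repeats x y z ⊎ Valid (x , y , z)
repeats? x y z with x ≟ y | x ≟ z | y ≟ z
... | yes x≡y | _ | _ = inj₁ (inj₁ x≡y)
... | no _ | yes x≡z | _ = inj₁ (inj₂ (inj₁ x≡z))
... | no _ | no _ | yes y≡z = inj₁ (inj₂ (inj₂ y≡z))
... | no x≢y | no x≢z | no y≢z = inj₂ (x≢y , x≢z , y≢z)

∈-length≡1 : ∀ {A : Set} {xs : List A} {x y} → length xs ≡ 1 → x ∈ xs → y ∈ xs → x ≡ y
∈-length≡1 {xs = _ ∷ []} _ (here refl) (here refl) = refl
∈-length≡1 {xs = _ ∷ _ ∷ _} ()

length-filterᵇ-∨ : ∀ {A : Set} (f g : A → Bool) → (∀ x → T (f x) → ¬ T (g x)) → (xs : List A) →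
  length (filterᵇ (λ x → f x ∨ g x) xs) ≡ length (filterᵇ f xs) + length (filterᵇ g xs)
length-filterᵇ-∨ f g disjoint [] = refl
length-filterᵇ-∨ f g disjoint (x ∷ xs) with f x | g x | disjoint x
... | true | true | fx⇒¬gx = ⊥-elim (fx⇒¬gx _ _)
... | true | false | _ = cong suc (length-filterᵇ-∨ f g disjoint xs)
... | false | true | _ = trans (cong suc (length-filterᵇ-∨ f g disjoint xs)) (sym (+-suc _ _))
... | false | false | _ = length-filterᵇ-∨ f g disjoint xs

witness₃ : ∀ {P Q R : Set} (p : Dec P) (q : Dec Q) (r : Dec R) → T (⌊ p ⌋ ∧ ⌊ q ⌋ ∧ ⌊ r ⌋) → P × Q × R
witness₃ (yes p) (yes q) (yes r) _ = p , q , r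
witness₃ (no _) _ _ ()
witness₃ (yes _) (no _) _ ()
witness₃ (yes _) (yes _) (no _) ()

module FeasibleStrategy {c : ℕ} (c≥5 : c ≥ 5) (qs : List (Triple c))
  (strategy : Strategy qs) (feasible : Feasible qs) where
  open Arrows {Fin c}
  open PegPair

  separated : ∀ {S T} → Valid S → Valid T → S ≢ T → ¬ (∀ {r} → r ∈ qs → answer r S ≡ answer r T)
  separated valid-S valid-T S≢T same = S≢T (feasible _ _ valid-S valid-T (All.tabulate same))

  Owns : PegPair c → Fin c → Fin c → Set
  Owns π a b = ∀ {r} → r ∈ qs → (first π r ≡ a ⇔ second π r ≡ b)

  -- Otherwise the secrets place a b′ w and place a′ b w, with a fresh colour w, are valid and
  -- receive the same answers.
  owners-linked : ∀ π {a b a′ b′} → Owns π a b → Owns π a′ b′ → a ≢ a′ → b ≡ a′ ⊎ b′ ≡ a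
  owners-linked π {a} {b} {a′} {b′} owns owns′ a≢a′
    with b ≟ a′ | b′ ≟ a | length<⇒∃∉ (a ∷ b ∷ a′ ∷ b′ ∷ []) c≥5
  ... | yes b≡a′ | _ | _ = inj₁ b≡a′
  ... | no _ | yes b′≡a | _ = inj₂ b′≡a
  ... | no b≢a′ | no b′≢a | w , w∉ = ⊥-elim (separated
    (valid-place π (≢-sym b′≢a) (w∉ ∘ here) (w∉ ∘ there ∘ there ∘ there ∘ here))
    (valid-place π (≢-sym b≢a′) (w∉ ∘ there ∘ there ∘ here) (w∉ ∘ there ∘ here))
    (λ S≡T → a≢a′ (trans (sym (first-place π)) (trans (cong (first π) S≡T) (first-place π))))
    λ {r} r∈ → begin
      answer r (place π a b′ w)
        ≡⟨ answer-place π r ⟩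
      eqℕ (first π r) a + eqℕ (second π r) b′ + eqℕ (third π r) w
        ≡⟨ cong (_+ eqℕ (third π r) w) (hits-exchange₂ (owns r∈) (owns′ r∈)) ⟩
      eqℕ (first π r) a′ + eqℕ (second π r) b + eqℕ (third π r) w
        ≡⟨ answer-place π r ⟨
      answer r (place π a′ b w) ∎)
    where open ≡-Reasoning

  owners-collide : ∀ {a₁ b₁ a₂ g₂ b₃ g₃} → Owns pegs₁₂ a₁ b₁ → Owns pegs₁₃ a₂ g₂ → Owns pegs₂₃ b₃ g₃ →
    a₁ ≢ a₂ → Repeats a₁ b₃ g₂ ⊎ Repeats a₂ b₁ g₃
  owners-collide {a₁} {b₁} {a₂} {g₂} {b₃} {g₃} owns₁ owns₂ owns₃ a₁≢a₂
    with repeats? a₁ b₃ g₂ | repeats? a₂ b₁ g₃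
  ... | inj₁ repeats | _ = inj₁ repeats
  ... | inj₂ _ | inj₁ repeats = inj₂ repeats
  ... | inj₂ valid-S | inj₂ valid-T = ⊥-elim (separated valid-S valid-T (a₁≢a₂ ∘ cong peg₁)
    λ r∈ → hits-exchange₃ (owns₁ r∈) (owns₂ r∈) (owns₃ r∈))

  record PegClass (π : PegPair c) : Set where
    field
      members : List (Triple c)
      unique : Unique members
      owns : ∀ {x} → x ∈ members → Owns π (first π x) (second π x)
      first-injective : ∀ {x y} → x ∈ members → y ∈ members → x ≢ y → first π x ≢ first π y
      second-injective : ∀ {x y} → x ∈ members → y ∈ members → x ≢ y → second π x ≢ second π y

    family : Family (Triple c)
    family = record
      { members = members ; unique = unique ; tail = first π ; head = second π
      ; tail-injective = first-injective ; head-injective = second-injective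
      ; linked = λ x∈ y∈ x≢y → owners-linked π (owns x∈) (owns y∈) (first-injective x∈ y∈ x≢y) }

  open PegClass using (members; owns; family)

  Cross : (Triple c → Fin c) → List (Triple c) → List (Triple c) → Set
  Cross pg xs ys = ∀ {x y} → x ∈ xs → y ∈ ys → pg x ≢ pg y

  configuration : (A : PegClass pegs₁₂) (B : PegClass pegs₁₃) (C : PegClass pegs₂₃) →
    Cross peg₁ (members A) (members B) → Cross peg₂ (members A) (members C) →
    Cross peg₃ (members B) (members C) → Configuration (Triple c)
  configuration A B C AB AC BC = record
    { A = family A ; B = family B ; C = family C
    ; tails-AB = AB ; head-tail-AC = AC ; heads-BC = BC
    ; collision = λ p∈ q∈ r∈ → owners-collide (owns A p∈) (owns B q∈) (owns C r∈) (AB p∈ q∈) }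

  absent : ∀ {pg u} → Absent pg qs u → ∀ {r} → r ∈ qs → pg r ≢ u
  absent none {r} r∈ same = none (r , r∈ , same)

  extend : ∀ {π} (K : PegClass π) → members K ⊆ qs → (v : Triple c) →
    Absent (first π) qs (first π v) → Absent (second π) qs (second π v) → PegClass π
  extend {π} K K⊆qs v none₁ none₂ = record
    { members = v ∷ members K
    ; unique = All.tabulate (λ x∈ v≡x → absent none₁ (K⊆qs x∈) (cong (first π) (sym v≡x)))
               ∷ PegClass.unique K
    ; owns = owns′
    ; first-injective = cons-injective (first π) none₁ (PegClass.first-injective K)
    ; second-injective = cons-injective (second π) none₂ (PegClass.second-injective K) }
    where
    owns′ : ∀ {x} → x ∈ v ∷ members K → Owns π (first π x) (second π x)
    owns′ (here refl) r∈ = mk⇔ (⊥-elim ∘ absent none₁ r∈) (⊥-elim ∘ absent none₂ r∈)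
    owns′ (there x∈) = owns K x∈

    cons-injective : ∀ (f : Triple c → Fin c) → Absent f qs (f v) →
      (∀ {x y} → x ∈ members K → y ∈ members K → x ≢ y → f x ≢ f y) →
      ∀ {x y} → x ∈ v ∷ members K → y ∈ v ∷ members K → x ≢ y → f x ≢ f y
    cons-injective f none injective (here refl) (here refl) v≢v = ⊥-elim (v≢v refl)
    cons-injective f none injective (here refl) (there y∈) _ = absent none (K⊆qs y∈) ∘ sym
    cons-injective f none injective (there x∈) (here refl) _ = absent none (K⊆qs x∈)
    cons-injective f none injective (there x∈) (there y∈) = injective x∈ y∈

  cross-consˡ : ∀ {pg xs ys v} → Cross pg xs ys → Absent pg qs (pg v) → ys ⊆ qs → Cross pg (v ∷ xs) ys
  cross-consˡ cross none ys⊆qs (here refl) y∈ = absent none (ys⊆qs y∈) ∘ sym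
  cross-consˡ cross none ys⊆qs (there x∈) y∈ = cross x∈ y∈

  cross-consʳ : ∀ {pg xs ys v} → Cross pg xs ys → Absent pg qs (pg v) → xs ⊆ qs → Cross pg xs (v ∷ ys)
  cross-consʳ cross none xs⊆qs x∈ (here refl) = absent none (xs⊆qs x∈)
  cross-consʳ cross none xs⊆qs x∈ (there y∈) = cross x∈ y∈

  proper : ∀ {π} (K : PegClass π) → members K ⊆ qs → Family.Proper (family K)
  proper {π} K K⊆qs x∈ = valid⇒distinct π (All.lookup (proj₁ strategy) (K⊆qs x∈))

  sole : ∀ (pg : Triple c → Fin c) {x r} → occ pg qs (pg x) ≡ 1 → x ∈ qs → r ∈ qs → pg r ≡ pg x → r ≡ x
  sole pg {x} occ≡1 x∈ r∈ same =
    ∈-length≡1 occ≡1 (∈-filter⁺ (λ q → pg q ≟ pg x) r∈ same) (∈-filter⁺ (λ q → pg q ≟ pg x) x∈ refl)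

  filterᵇ⊆ : ∀ (b : Triple c → Bool) → filterᵇ b qs ⊆ qs
  filterᵇ⊆ b = proj₁ ∘ ∈-filter⁻ (T? ∘ b)

  special-class : ∀ π (b : Triple c → Bool) →
    (∀ {x} → T (b x) → occ (first π) qs (first π x) ≡ 1) →
    (∀ {x} → T (b x) → occ (second π) qs (second π x) ≡ 1) → PegClass π
  special-class π b sole₁ sole₂ = record
    { members = filterᵇ b qs
    ; unique = filter⁺ (T? ∘ b) (proj₂ strategy)
    ; owns = λ x∈ r∈ → let (x∈qs , bx) = ∈-filter⁻ (T? ∘ b) x∈ in
        mk⇔ (cong (second π) ∘ sole (first π) (sole₁ bx) x∈qs r∈)
            (cong (first π) ∘ sole (second π) (sole₂ bx) x∈qs r∈)
    ; first-injective = injective (first π) sole₁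
    ; second-injective = injective (second π) sole₂ }
    where
    injective : ∀ (pg : Triple c → Fin c) → (∀ {x} → T (b x) → occ pg qs (pg x) ≡ 1) →
      ∀ {x y} → x ∈ filterᵇ b qs → y ∈ filterᵇ b qs → x ≢ y → pg x ≢ pg y
    injective pg sole-pg x∈ y∈ x≢y same =
      let (x∈qs , bx) = ∈-filter⁻ (T? ∘ b) x∈ in
      x≢y (sym (sole pg (sole-pg bx) x∈qs (filterᵇ⊆ b y∈) (sym same)))

  special-cross : ∀ pg {b b′ : Triple c → Bool} → (∀ {x} → T (b x) → occ pg qs (pg x) ≡ 1) →
    (∀ {x} → T (b x) → ¬ T (b′ x)) → Cross pg (filterᵇ b qs) (filterᵇ b′ qs)
  special-cross pg {b} {b′} sole-pg exclusive x∈ y∈ same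
    with ∈-filter⁻ (T? ∘ b) x∈ | ∈-filter⁻ (T? ∘ b′) y∈
  ... | x∈qs , bx | y∈qs , b′y with sole pg (sole-pg bx) x∈qs y∈qs (sym same)
  ...   | refl = exclusive bx b′y

  special₁₂ special₁₃ special₂₃ : Triple c → Bool
  special₁₂ q = ⌊ m₁ qs q ≟1 ⌋ ∧ ⌊ m₂ qs q ≟1 ⌋ ∧ ⌊ m₃ qs q ≥2? ⌋
  special₁₃ q = ⌊ m₁ qs q ≟1 ⌋ ∧ ⌊ m₂ qs q ≥2? ⌋ ∧ ⌊ m₃ qs q ≟1 ⌋
  special₂₃ q = ⌊ m₁ qs q ≥2? ⌋ ∧ ⌊ m₂ qs q ≟1 ⌋ ∧ ⌊ m₃ qs q ≟1 ⌋

  special₁₂-occ : ∀ {q} → T (special₁₂ q) → m₁ qs q ≡ 1 × m₂ qs q ≡ 1 × m₃ qs q ≥ 2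
  special₁₂-occ {q} = witness₃ (m₁ qs q ≟1) (m₂ qs q ≟1) (m₃ qs q ≥2?)

  special₁₃-occ : ∀ {q} → T (special₁₃ q) → m₁ qs q ≡ 1 × m₂ qs q ≥ 2 × m₃ qs q ≡ 1
  special₁₃-occ {q} = witness₃ (m₁ qs q ≟1) (m₂ qs q ≥2?) (m₃ qs q ≟1)

  special₂₃-occ : ∀ {q} → T (special₂₃ q) → m₁ qs q ≥ 2 × m₂ qs q ≡ 1 × m₃ qs q ≡ 1
  special₂₃-occ {q} = witness₃ (m₁ qs q ≥2?) (m₂ qs q ≟1) (m₃ qs q ≟1)

  ≡1⇒≱2 : ∀ {n} → n ≡ 1 → ¬ n ≥ 2
  ≡1⇒≱2 refl (s≤s ())

  exclusive₁₂₋₁₃ : ∀ {q} → T (special₁₂ q) → ¬ T (special₁₃ q)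
  exclusive₁₂₋₁₃ s₁₂ s₁₃ = ≡1⇒≱2 (proj₁ (proj₂ (special₁₂-occ s₁₂))) (proj₁ (proj₂ (special₁₃-occ s₁₃)))

  exclusive₁₂₋₂₃ : ∀ {q} → T (special₁₂ q) → ¬ T (special₂₃ q)
  exclusive₁₂₋₂₃ s₁₂ s₂₃ = ≡1⇒≱2 (proj₁ (special₁₂-occ s₁₂)) (proj₁ (special₂₃-occ s₂₃))

  exclusive₁₃₋₂₃ : ∀ {q} → T (special₁₃ q) → ¬ T (special₂₃ q)
  exclusive₁₃₋₂₃ s₁₃ s₂₃ = ≡1⇒≱2 (proj₁ (special₁₃-occ s₁₃)) (proj₁ (special₂₃-occ s₂₃))

  count₁₂ count₁₃ count₂₃ : ℕ
  count₁₂ = length (filterᵇ special₁₂ qs)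
  count₁₃ = length (filterᵇ special₁₃ qs)
  count₂₃ = length (filterᵇ special₂₃ qs)

  numSpecial≡ : numSpecial qs ≡ count₁₂ + count₁₃ + count₂₃
  numSpecial≡ = begin
    numSpecial qs
      ≡⟨ length-filterᵇ-∨ special₁₂ (λ q → special₁₃ q ∨ special₂₃ q)
           (λ _ s₁₂ → [ exclusive₁₂₋₁₃ s₁₂ , exclusive₁₂₋₂₃ s₁₂ ] ∘ Equivalence.to T-∨) qs ⟩
    count₁₂ + length (filterᵇ (λ q → special₁₃ q ∨ special₂₃ q) qs)
      ≡⟨ cong (count₁₂ +_) (length-filterᵇ-∨ special₁₃ special₂₃ (λ _ → exclusive₁₃₋₂₃) qs) ⟩
    count₁₂ + (count₁₃ + count₂₃)
      ≡⟨ +-assoc count₁₂ count₁₃ count₂₃ ⟨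
    count₁₂ + count₁₃ + count₂₃ ∎
    where open ≡-Reasoning

  class₁₂ : PegClass pegs₁₂
  class₁₂ = special-class pegs₁₂ special₁₂ (proj₁ ∘ special₁₂-occ) (proj₁ ∘ proj₂ ∘ special₁₂-occ)

  class₁₃ : PegClass pegs₁₃
  class₁₃ = special-class pegs₁₃ special₁₃ (proj₁ ∘ special₁₃-occ) (proj₂ ∘ proj₂ ∘ special₁₃-occ)

  class₂₃ : PegClass pegs₂₃
  class₂₃ =
    special-class pegs₂₃ special₂₃ (proj₁ ∘ proj₂ ∘ special₂₃-occ) (proj₂ ∘ proj₂ ∘ special₂₃-occ)

  cross₁ : Cross peg₁ (members class₁₂) (members class₁₃)
  cross₁ = special-cross peg₁ (proj₁ ∘ special₁₂-occ) exclusive₁₂₋₁₃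

  cross₂ : Cross peg₂ (members class₁₂) (members class₂₃)
  cross₂ = special-cross peg₂ (proj₁ ∘ proj₂ ∘ special₁₂-occ) exclusive₁₂₋₂₃

  cross₃ : Cross peg₃ (members class₁₃) (members class₂₃)
  cross₃ = special-cross peg₃ (proj₂ ∘ proj₂ ∘ special₁₃-occ) exclusive₁₃₋₂₃

  proper₁₂ : Family.Proper (family class₁₂)
  proper₁₂ = proper class₁₂ (filterᵇ⊆ special₁₂)
  proper₁₃ : Family.Proper (family class₁₃)
  proper₁₃ = proper class₁₃ (filterᵇ⊆ special₁₃)
  proper₂₃ : Family.Proper (family class₂₃)
  proper₂₃ = proper class₂₃ (filterᵇ⊆ special₂₃)

  at-most-six : numSpecial qs ≤ 6
  at-most-six = begin
    numSpecial qs                ≡⟨ numSpecial≡ ⟩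
    count₁₂ + count₁₃ + count₂₃  ≤⟨ size-bound K (inj₁ proper₁₂) (inj₁ proper₁₂) (inj₁ proper₁₃) ⟩
    6                            ∎
    where
    open ≤-Reasoning
    K : Configuration (Triple c)
    K = configuration class₁₂ class₁₃ class₂₃ cross₁ cross₂ cross₃

  -- A colour u missing on peg i and a colour v missing on peg j act like one more
  -- (i,j)-question showing u and v, which no question can meet. That question may
  -- repeat a colour, so only the other two classes are known to be proper.
  missing₁₂ : ∀ {u v} → Absent peg₁ qs u → Absent peg₂ qs v → suc (numSpecial qs) ≤ 6
  missing₁₂ {u} {v} none₁ none₂ = begin
    suc (numSpecial qs)                ≡⟨ cong suc numSpecial≡ ⟩
    suc count₁₂ + count₁₃ + count₂₃    ≤⟨ size-bound K (inj₂ proper₁₃) (inj₂ proper₂₃) (inj₁ proper₁₃) ⟩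
    6                                  ∎
    where
    open ≤-Reasoning
    K : Configuration (Triple c)
    K = configuration (extend class₁₂ (filterᵇ⊆ special₁₂) (u , v , u) none₁ none₂) class₁₃ class₂₃
      (cross-consˡ cross₁ none₁ (filterᵇ⊆ special₁₃))
      (cross-consˡ cross₂ none₂ (filterᵇ⊆ special₂₃))
      cross₃

  missing₁₃ : ∀ {u v} → Absent peg₁ qs u → Absent peg₃ qs v → suc (numSpecial qs) ≤ 6
  missing₁₃ {u} {v} none₁ none₃ = begin
    suc (numSpecial qs)                ≡⟨ cong suc numSpecial≡ ⟩
    suc (count₁₂ + count₁₃) + count₂₃  ≡⟨ cong (_+ count₂₃) (+-suc count₁₂ count₁₃) ⟨
    count₁₂ + suc count₁₃ + count₂₃    ≤⟨ size-bound K (inj₁ proper₁₂) (inj₁ proper₁₂) (inj₂ proper₂₃) ⟩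
    6                                  ∎
    where
    open ≤-Reasoning
    K : Configuration (Triple c)
    K = configuration class₁₂ (extend class₁₃ (filterᵇ⊆ special₁₃) (u , u , v) none₁ none₃) class₂₃
      (cross-consʳ cross₁ none₁ (filterᵇ⊆ special₁₂))
      cross₂
      (cross-consˡ cross₃ none₃ (filterᵇ⊆ special₂₃))

  missing₂₃ : ∀ {u v} → Absent peg₂ qs u → Absent peg₃ qs v → suc (numSpecial qs) ≤ 6
  missing₂₃ {u} {v} none₂ none₃ = begin
    suc (numSpecial qs)                ≡⟨ cong suc numSpecial≡ ⟩
    suc (count₁₂ + count₁₃ + count₂₃)  ≡⟨ +-suc (count₁₂ + count₁₃) count₂₃ ⟨
    count₁₂ + count₁₃ + suc count₂₃    ≤⟨ size-bound K (inj₁ proper₁₂) (inj₁ proper₁₂) (inj₁ proper₁₃) ⟩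
    6                                  ∎
    where
    open ≤-Reasoning
    K : Configuration (Triple c)
    K = configuration class₁₂ class₁₃ (extend class₂₃ (filterᵇ⊆ special₂₃) (u , u , v) none₂ none₃)
      cross₁
      (cross-consʳ cross₂ none₂ (filterᵇ⊆ special₁₂))
      (cross-consʳ cross₃ none₃ (filterᵇ⊆ special₁₃))

  at-most-five : (∃ λ (i : Fin 3) → ∃ λ (j : Fin 3) → i ≢ j × MissesColor qs i × MissesColor qs j) →
    numSpecial qs ≤ 5
  at-most-five (i , j , i≢j , (_ , none-i) , (_ , none-j)) = ≤-pred (by-pegs i j i≢j none-i none-j)
    where
    by-pegs : ∀ i j {u v} → i ≢ j → Absent (pegAt i) qs u → Absent (pegAt j) qs v →
      suc (numSpecial qs) ≤ 6
    by-pegs fzero fzero i≢i = ⊥-elim (i≢i refl)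
    by-pegs fzero (fsuc fzero) _ = missing₁₂
    by-pegs fzero (fsuc (fsuc fzero)) _ = missing₁₃
    by-pegs (fsuc fzero) fzero _ = flip missing₁₂
    by-pegs (fsuc fzero) (fsuc fzero) i≢i = ⊥-elim (i≢i refl)
    by-pegs (fsuc fzero) (fsuc (fsuc fzero)) _ = missing₂₃
    by-pegs (fsuc (fsuc fzero)) fzero _ = flip missing₁₃
    by-pegs (fsuc (fsuc fzero)) (fsuc fzero) _ = flip missing₂₃
    by-pegs (fsuc (fsuc fzero)) (fsuc (fsuc fzero)) i≢i = ⊥-elim (i≢i refl)

lemma5 : (c : ℕ) → c ≥ 5 → (qs : List (Triple c)) → Strategy qs → Feasible qs →
  ¬ (∃ λ q → q ∈ qs × Is111 qs q) →
  (numSpecial qs ≤ 6)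
  × ((∃ λ (i : Fin 3) → ∃ λ (j : Fin 3) → i ≢ j × MissesColor qs i × MissesColor qs j) →
     numSpecial qs ≤ 5)
-- The bound does not need the absence of (1,1,1)-questions.
lemma5 c c≥5 qs strategy feasible _ = at-most-six , at-most-five
  where open FeasibleStrategy c≥5 qs strategy feasible
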